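{- Let $\Gamma_{1}=(V_{1},E_{1})$ be a (simple, undirected) graph with a strong edge coloring $\mathcal{E}_{1}$, and let $\Gamma_{2}=(V_{2},W_{2},E_{2})$ be a bipartite graph with a strong edge coloring $\mathcal{E}_{2}$ with colors from $\mathcal{S}_{2}$. Let $\mathcal{E}^{\circ}$ and $\mathcal{E}_{\circ}$ be two opposing orientations of $\mathcal{E}_{1}$ with mutually disjoint sets of colors $\mathcal{S}^{\circ}$ and $\mathcal{S}_{\circ}$, respectively, and suppose there exists a proper vertex coloring $\mathcal{V}$ of $\Gamma_{1}$ with colors from a set $\mathcal{S}'$ with $\mathcal{S}^{\circ}\cap\mathcal{S}'=\mathcal{S}_{\circ}\cap\mathcal{S}'=\emptyset$. Let $\Gamma=\Gamma_{1}:\Gamma_{2}$ be the bipartite graph $(V_{1}\times V_{2},\,V_{1}\times W_{2},\,E)$ where \[E=\{((x,y),(u,v))\mid (y,v)\in E_{2},\text{ and either }x=u\text{ or }\{x,u\}\in E_{1}\}.\] Then \[\mathcal{E}=\{((x,y),(u,v),(s,s_{2}))\mid (y,v,s_{2})\in\mathcal{E}_{2};\text{ and either } x=u\text{ with }(x,s)\in\mathcal{V},\text{ or }(\langle x,u\rangle,s)\in\mathcal{E}^{\circ}\cup\mathcal{E}_{\circ}\}\] is a strong edge coloring of $\Gamma$ with colors from $\mathcal{S}=(\mathcal{S}'\cup\mathcal{S}^{\circ}\cup\mathcal{S}_{\circ})\times\mathcal{S}_{2}$.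
   Context: An edge coloring of a graph $(V,E)$ with colors from $\mathcal{S}$ is a set of pairs $(\{x,y\},s)$, one for each edge $\{x,y\}\in E$, giving its color; it is proper if adjacent edges get different colors, and a strong edge coloring if in addition no two edges of the same color are joined by an edge (any two distinct edges of the same color are vertex-disjoint and no edge of the graph has one endpoint on each). For a bipartite graph $(V_1,V_2,E)$ (with $E\subseteq V_1\times V_2$), an edge coloring is written as triples $(v_1,v_2,s)$. A proper vertex coloring $\mathcal{V}$ with colors from $\mathcal{S}'$ is a set of pairs $(v,s)$, one for each vertex, such that adjacent vertices get different colors. For an undirected graph $(V,E)$ let $D(E)=\{\langle x,y\rangle,\langle y,x\rangle\mid \{x,y\}\in E\}$, where $\langle x,y\rangle$ denotes the directed edge $x\to y$. An orientation of an edge coloring $\mathcal{E}_1$ is a set $\mathcal{E}^{\circ}\subseteq D(E)\times\mathcal{S}$ containing, for each $(\{x,y\},s)\in\mathcal{E}_1$, exactly one of $(\langle x,y\rangle,s)$, $(\langle y,x\rangle,s)$. Two opposing orientations with mutually disjoint color sets $\mathcal{S}^{\circ},\mathcal{S}_{\circ}$ (with $\mathcal{S}^{\circ}\cap\mathcal{S}_{\circ}=\emptyset$) means: $\mathcal{E}^{\circ}$ is an orientation of $\mathcal{E}_1$ whose colors are those of $\mathcal{E}_1$, taken as $\mathcal{S}^{\circ}$, and there is a bijection $\varphi:\mathcal{S}^{\circ}\to\mathcal{S}_{\circ}$ such that $\mathcal{E}_{\circ}=\{(\langle y,x\rangle,\varphi(s))\mid (\langle x,y\rangle,s)\in\mathcal{E}^{\circ}\}$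 (the reversed edges, recolored by $\varphi$). -}

module Defs where

open import Data.Product using (Σ; Σ-syntax; _×_; _,_)
open import Data.Sum using (_⊎_)
open import Relation.Nullary using (¬_)
open import Relation.Binary.PropositionalEquality using (_≡_; _≢_)
open import Function.Bundles using (_⇔_)

record Graph : Set₁ where
  field
    V     : Set
    Adj   : V → V → Set
    sym   : ∀ {x y} → Adj x y → Adj y x
    irrefl : ∀ {x} → ¬ Adj x x
open Graph public

record BipGraph : Set₁ where
  field
    L   : Set
    R   : Set
    Adj : L → R → Set
open BipGraph public

∃!′ : {A : Set} → (A → Set) → Set
∃!′ {A} P = Σ[ a ∈ A ] (P a × (∀ b → P b → a ≡ b))

-- Edge colorings of an undirected graph, as sets of pairs ({x,y}, s).
-- The set is a relation  C x y s  ("({x,y},s) ∈ C"); since {x,y} is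
-- unordered, C is required to be symmetric in x, y.

module _ (G : Graph) {S : Set} (C : V G → V G → S → Set) where

  SameEdge : V G → V G → V G → V G → Set
  SameEdge a b c d = (a ≡ c × b ≡ d) ⊎ (a ≡ d × b ≡ c)

  IsEdgeColoring : Set
  IsEdgeColoring =
      (∀ x y s → C x y s → Adj G x y)
    × (∀ x y s → C x y s → C y x s)
    × (∀ x y → Adj G x y → ∃!′ (C x y))

  ProperEC : Set
  ProperEC = ∀ a b c d s → C a b s → C c d s → ¬ SameEdge a b c d →
    ¬ (a ≡ c ⊎ a ≡ d ⊎ b ≡ c ⊎ b ≡ d)

  StrongCond : Set
  StrongCond = ∀ a b c d s → C a b s → C c d s → ¬ SameEdge a b c d →
      (a ≢ c × a ≢ d × b ≢ c × b ≢ d)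
    × (¬ Adj G a c × ¬ Adj G a d × ¬ Adj G b c × ¬ Adj G b d)

  IsStrongEdgeColoring : Set
  IsStrongEdgeColoring = IsEdgeColoring × ProperEC × StrongCond

  ColorsFrom : (S → Set) → Set
  ColorsFrom P = ∀ x y s → C x y s → P s

module _ (G : BipGraph) {S : Set} (C : L G → R G → S → Set) where

  IsBipEdgeColoring : Set
  IsBipEdgeColoring =
      (∀ v w s → C v w s → Adj G v w)
    × (∀ v w → Adj G v w → ∃!′ (C v w))

  BipProper : Set
  BipProper = ∀ v w v′ w′ s → C v w s → C v′ w′ s → ¬ (v ≡ v′ × w ≡ w′) →
    ¬ (v ≡ v′ ⊎ w ≡ w′)

  BipStrongCond : Set
  BipStrongCond = ∀ v w v′ w′ s → C v w s → C v′ w′ s → ¬ (v ≡ v′ × w ≡ w′) →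
    (v ≢ v′ × w ≢ w′) × (¬ Adj G v w′ × ¬ Adj G v′ w)

  IsBipStrongEdgeColoring : Set
  IsBipStrongEdgeColoring = IsBipEdgeColoring × BipProper × BipStrongCond

  BipColorsFrom : (S → Set) → Set
  BipColorsFrom P = ∀ v w s → C v w s → P s

IsProperVertexColoring : (G : Graph) {S : Set} → (V G → S → Set) → Set
IsProperVertexColoring G 𝒱 =
    (∀ x → ∃!′ (𝒱 x))
  × (∀ x u s → Adj G x u → 𝒱 x s → 𝒱 u s → ⊥′)
  where open import Data.Empty renaming (⊥ to ⊥′)

-- Orientations.  A directed edge ⟨x,y⟩ with color s in 𝓔° is  O x y s.

IsOrientation : (G : Graph) {S : Set} → (V G → V G → S → Set) →
                (V G → V G → S → Set) → Set
IsOrientation G C O =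
    (∀ x y s → O x y s → C x y s)
  × (∀ x y s → C x y s → (O x y s ⊎ O y x s) × ¬ (O x y s × O y x s))

-- Two opposing orientations O° (colors S°) and O∘ (colors S∘) of C with
-- mutually disjoint color sets, related by the bijection φ : S° → S∘.
record OpposingOrientations (G : Graph) {S : Set}
         (C : V G → V G → S → Set)
         (O° O∘ : V G → V G → S → Set)
         (S° S∘ : S → Set) : Set where
  field
    φ            : S → S
    orient       : IsOrientation G C O°
    colors°      : ColorsFrom G C S°   -- colors of C, taken as S°
    disjoint     : ∀ s → S° s → ¬ S∘ s
    φ-into       : ∀ s → S° s → S∘ (φ s)
    φ-injective  : ∀ s t → S° s → S° t → φ s ≡ φ t → s ≡ t
    φ-surjective : ∀ t → S∘ t → Σ[ s ∈ S ] (S° s × φ s ≡ t)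
    opposing     : ∀ x y t → O∘ x y t ⇔ (Σ[ s ∈ S ] (O° y x s × t ≡ φ s))

_∶_ : Graph → BipGraph → BipGraph
Γ₁ ∶ Γ₂ = record
  { L   = V Γ₁ × L Γ₂
  ; R   = V Γ₁ × R Γ₂
  ; Adj = λ { (x , y) (u , v) → Adj Γ₂ y v × (x ≡ u ⊎ Adj Γ₁ x u) }
  }

productColoring : (Γ₁ : Graph) (Γ₂ : BipGraph) {S S₂ : Set}
  (𝓔₂ : L Γ₂ → R Γ₂ → S₂ → Set)
  (𝒱 : V Γ₁ → S → Set)
  (O° O∘ : V Γ₁ → V Γ₁ → S → Set) →
  L (Γ₁ ∶ Γ₂) → R (Γ₁ ∶ Γ₂) → S × S₂ → Set
productColoring Γ₁ Γ₂ 𝓔₂ 𝒱 O° O∘ (x , y) (u , v) (s , s₂) =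
  𝓔₂ y v s₂ × ((x ≡ u × 𝒱 x s) ⊎ (O° x u s ⊎ O∘ x u s))

module Submission where

open import Defs hiding (sym)
open import Data.Product using (Σ-syntax; _×_; _,_; proj₁; proj₂)
open import Data.Sum using (_⊎_; inj₁; inj₂; [_,_])
open import Data.Empty using (⊥-elim)
open import Function using (_∘_)
open import Function.Bundles using (Equivalence)
open import Relation.Nullary using (¬_; yes; no)
open import Relation.Nullary.Decidable using (¬¬-excluded-middle)
open import Relation.Binary.PropositionalEquality
  using (_≡_; _≢_; refl; sym; trans; cong; cong₂; subst)

-- The coloring factors as a product of two colorings: 𝓔₂ on
-- Γ₂, and on the "looped" graph of Γ₁ (every vertex adjacent to itself,
-- seen as a bipartite graph V₁ × V₁) the coloring that gives a loop (x, x)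
-- the color of x in 𝒱 and the arc (x, u) its color in 𝓔° ∪ 𝓔∘.  The
-- latter is strong: two arcs of one color both come from 𝓔° (or, reversed,
-- both from 𝓔∘, since φ is injective), hence from two distinct edges of the
-- strong coloring 𝓔₁; two loops of one color are non-adjacent because 𝒱 is
-- proper; and loops never share a color with arcs.  A product of strong
-- bipartite colorings is strong: two distinct edges of the same color differ
-- in some factor, and that factor already separates them.

∃!′-unique : {A : Set} {P : A → Set} → ∃!′ P → ∀ {a b} → P a → P b → a ≡ b
∃!′-unique (c , _ , c-least) pa pb = trans (sym (c-least _ pa)) (c-least _ pb)

bipStrongCond⇒bipProper : {H : BipGraph} {S : Set} {C : L H → R H → S → Set} →
  BipStrongCond H C → BipProper H C
bipStrongCond⇒bipProper strong v w v′ w′ s c c′ distinct (inj₁ v≡v′) =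
  proj₁ (proj₁ (strong v w v′ w′ s c c′ distinct)) v≡v′
bipStrongCond⇒bipProper strong v w v′ w′ s c c′ distinct (inj₂ w≡w′) =
  proj₂ (proj₁ (strong v w v′ w′ s c c′ distinct)) w≡w′

isBipStrongEdgeColoring : {H : BipGraph} {S : Set} {C : L H → R H → S → Set} →
  IsBipEdgeColoring H C → BipStrongCond H C → IsBipStrongEdgeColoring H C
isBipStrongEdgeColoring {H} {C = C} isColoring strong =
  isColoring , bipStrongCond⇒bipProper {H} {C = C} strong , strong

-- The factors are listed in this order so that  looped Γ₁ ⊗ Γ₂  is
-- definitionally  Γ₁ ∶ Γ₂.
_⊗_ : BipGraph → BipGraph → BipGraph
H₁ ⊗ H₂ = record
  { L   = L H₁ × L H₂
  ; R   = R H₁ × R H₂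
  ; Adj = λ { (x , y) (u , v) → Adj H₂ y v × Adj H₁ x u }
  }

_⊗ᶜ_ : {H₁ H₂ : BipGraph} {S₁ S₂ : Set} →
  (L H₁ → R H₁ → S₁ → Set) → (L H₂ → R H₂ → S₂ → Set) →
  L (H₁ ⊗ H₂) → R (H₁ ⊗ H₂) → S₁ × S₂ → Set
(C₁ ⊗ᶜ C₂) (x , y) (u , v) (s₁ , s₂) = C₂ y v s₂ × C₁ x u s₁

module _ {H₁ H₂ : BipGraph} {S₁ S₂ : Set}
         {C₁ : L H₁ → R H₁ → S₁ → Set} {C₂ : L H₂ → R H₂ → S₂ → Set} where

  private
    C : L (H₁ ⊗ H₂) → R (H₁ ⊗ H₂) → S₁ × S₂ → Set
    C = _⊗ᶜ_ {H₁} {H₂} C₁ C₂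

  ⊗-isBipEdgeColoring : IsBipEdgeColoring H₁ C₁ → IsBipEdgeColoring H₂ C₂ →
    IsBipEdgeColoring (H₁ ⊗ H₂) C
  ⊗-isBipEdgeColoring (adj₁ , unique₁) (adj₂ , unique₂) = adj , unique
    where
    adj : ∀ a b s → C a b s → Adj (H₁ ⊗ H₂) a b
    adj (x , y) (u , v) (s₁ , s₂) (c₂ , c₁) = adj₂ y v s₂ c₂ , adj₁ x u s₁ c₁

    unique : ∀ a b → Adj (H₁ ⊗ H₂) a b → ∃!′ (C a b)
    unique (x , y) (u , v) (a₂ , a₁)
      with unique₁ x u a₁ | unique₂ y v a₂
    ... | s₁ , c₁ , least₁ | s₂ , c₂ , least₂ =
      (s₁ , s₂) , (c₂ , c₁) ,
      λ { (t₁ , t₂) (d₂ , d₁) → cong₂ _,_ (least₁ t₁ d₁) (least₂ t₂ d₂) }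

  ⊗-bipStrongCond : BipStrongCond H₁ C₁ → BipStrongCond H₂ C₂ →
    BipStrongCond (H₁ ⊗ H₂) C
  ⊗-bipStrongCond strong₁ strong₂
    (x , y) (u , v) (x′ , y′) (u′ , v′) (s₁ , s₂) (c₂ , c₁) (c₂′ , c₁′) distinct =
      ( bySeparatingFactor (λ sep eq → proj₁ (proj₁ sep) (cong proj₁ eq))
                           (λ sep eq → proj₁ (proj₁ sep) (cong proj₂ eq))
      , bySeparatingFactor (λ sep eq → proj₂ (proj₁ sep) (cong proj₁ eq))
                           (λ sep eq → proj₂ (proj₁ sep) (cong proj₂ eq)))
    , ( bySeparatingFactor (λ sep a → proj₁ (proj₂ sep) (proj₂ a))
                           (λ sep a → proj₁ (proj₂ sep) (proj₁ a))
      , bySeparatingFactor (λ sep a → proj₂ (proj₂ sep) (proj₂ a))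
                           (λ sep a → proj₂ (proj₂ sep) (proj₁ a)))
    where
    Separated₁ Separated₂ : Set
    Separated₁ = (x ≢ x′ × u ≢ u′) × (¬ Adj H₁ x u′ × ¬ Adj H₁ x′ u)
    Separated₂ = (y ≢ y′ × v ≢ v′) × (¬ Adj H₂ y v′ × ¬ Adj H₂ y′ v)

    -- Every conclusion is a negation, so we may decide whether the edges
    -- coincide in the second factor.
    bySeparatingFactor : {P : Set} → (Separated₁ → ¬ P) → (Separated₂ → ¬ P) → ¬ P
    bySeparatingFactor by₁ by₂ p = ¬¬-excluded-middle λ where
      (no distinct₂) → by₂ (strong₂ y v y′ v′ s₂ c₂ c₂′ distinct₂) p
      (yes (y≡y′ , v≡v′)) → by₁ (strong₁ x u x′ u′ s₁ c₁ c₁′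
        (λ (x≡x′ , u≡u′) → distinct (cong₂ _,_ x≡x′ y≡y′ , cong₂ _,_ u≡u′ v≡v′))) p

  ⊗-isBipStrongEdgeColoring : IsBipStrongEdgeColoring H₁ C₁ → IsBipStrongEdgeColoring H₂ C₂ →
    IsBipStrongEdgeColoring (H₁ ⊗ H₂) C
  ⊗-isBipStrongEdgeColoring (col₁ , _ , strong₁) (col₂ , _ , strong₂) =
    isBipStrongEdgeColoring {H₁ ⊗ H₂} {C = C}
      (⊗-isBipEdgeColoring col₁ col₂) (⊗-bipStrongCond strong₁ strong₂)

  ⊗-bipColorsFrom : {P : S₁ → Set} → BipColorsFrom H₁ C₁ P →
    BipColorsFrom (H₁ ⊗ H₂) C (P ∘ proj₁)
  ⊗-bipColorsFrom colors (x , y) (u , v) (s₁ , s₂) (_ , c₁) = colors x u s₁ c₁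

looped : Graph → BipGraph
looped Γ = record { L = V Γ ; R = V Γ ; Adj = λ x u → x ≡ u ⊎ Adj Γ x u }

Arc : {V S : Set} → (V → V → S → Set) → (V → V → S → Set) → V → V → S → Set
Arc O° O∘ x u s = O° x u s ⊎ O∘ x u s

loopedColoring : {V S : Set} → (V → S → Set) → (V → V → S → Set) → (V → V → S → Set) →
  V → V → S → Set
loopedColoring 𝒱 O° O∘ x u s = (x ≡ u × 𝒱 x s) ⊎ Arc O° O∘ x u s

Separated : (Γ : Graph) → V Γ → V Γ → V Γ → V Γ → Set
Separated Γ a b c d = (a ≢ c × a ≢ d × b ≢ c × b ≢ d)
                    × (¬ Adj Γ a c × ¬ Adj Γ a d × ¬ Adj Γ b c × ¬ Adj Γ b d)

module _ {Γ : Graph} where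

  Separated-reverse : ∀ {a b c d} → Separated Γ b a d c → Separated Γ a b c d
  Separated-reverse ((b≢d , b≢c , a≢d , a≢c) , (¬bd , ¬bc , ¬ad , ¬ac)) =
    (a≢c , a≢d , b≢c , b≢d) , (¬ac , ¬ad , ¬bc , ¬bd)

  Separated⇒looped-separated : ∀ {x u x′ u′} → Separated Γ x u x′ u′ →
    (x ≢ x′ × u ≢ u′) × (¬ Adj (looped Γ) x u′ × ¬ Adj (looped Γ) x′ u)
  Separated⇒looped-separated ((x≢x′ , x≢u′ , u≢x′ , u≢u′) , (_ , ¬xu′ , ¬ux′ , _)) =
    (x≢x′ , u≢u′) , [ x≢u′ , ¬xu′ ] , [ u≢x′ ∘ sym , ¬ux′ ∘ Graph.sym Γ ]

module _ {Γ : Graph} {S : Set} {𝓔₁ O° O∘ : V Γ → V Γ → S → Set} {S° S∘ : S → Set}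
         (isColoring : IsEdgeColoring Γ 𝓔₁)
         (opposing : OpposingOrientations Γ 𝓔₁ O° O∘ S° S∘) where

  open OpposingOrientations opposing hiding (opposing)
  private
    𝓔₁-adj : ∀ x u s → 𝓔₁ x u s → Adj Γ x u
    𝓔₁-adj = proj₁ isColoring

    𝓔₁-sym : ∀ x u s → 𝓔₁ x u s → 𝓔₁ u x s
    𝓔₁-sym = proj₁ (proj₂ isColoring)

    𝓔₁-unique : ∀ x u → Adj Γ x u → ∃!′ (𝓔₁ x u)
    𝓔₁-unique = proj₂ (proj₂ isColoring)

    O°⊆𝓔₁ : ∀ x u s → O° x u s → 𝓔₁ x u s
    O°⊆𝓔₁ = proj₁ orient

  𝓔₁-functional : ∀ {x u s t} → 𝓔₁ x u s → 𝓔₁ x u t → s ≡ t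
  𝓔₁-functional {x} {u} {s} c = ∃!′-unique (𝓔₁-unique x u (𝓔₁-adj x u s c)) c

  O∘⇒reversed-O° : ∀ {x u s} → O∘ x u s → Σ[ t ∈ S ] (O° u x t × s ≡ φ t)
  O∘⇒reversed-O° = Equivalence.to (OpposingOrientations.opposing opposing _ _ _)

  reversed-O°⇒O∘ : ∀ {x u t} → O° u x t → O∘ x u (φ t)
  reversed-O°⇒O∘ o = Equivalence.from (OpposingOrientations.opposing opposing _ _ _) (_ , o , refl)

  O°-functional : ∀ {x u s t} → O° x u s → O° x u t → s ≡ t
  O°-functional o o′ = 𝓔₁-functional (O°⊆𝓔₁ _ _ _ o) (O°⊆𝓔₁ _ _ _ o′)

  O°-antisym : ∀ {x u s t} → O° x u s → ¬ O° u x t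
  O°-antisym {x} {u} {s} {t} o o′ =
    proj₂ (proj₂ orient x u s c) (o , subst (O° u x) t≡s o′)
    where
    c : 𝓔₁ x u s
    c = O°⊆𝓔₁ x u s o

    t≡s : t ≡ s
    t≡s = 𝓔₁-functional (𝓔₁-sym u x t (O°⊆𝓔₁ u x t o′)) c

  colors∘ : ∀ {x u s} → O∘ x u s → S∘ s
  colors∘ o with O∘⇒reversed-O° o
  ... | t , o′ , refl = φ-into t (colors° _ _ t (O°⊆𝓔₁ _ _ t o′))

  arc-colors : ∀ {x u s} → Arc O° O∘ x u s → S° s ⊎ S∘ s
  arc-colors (inj₁ o) = inj₁ (colors° _ _ _ (O°⊆𝓔₁ _ _ _ o))
  arc-colors (inj₂ o) = inj₂ (colors∘ o)

  arc-adj : ∀ {x u s} → Arc O° O∘ x u s → Adj Γ x u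
  arc-adj (inj₁ o) = 𝓔₁-adj _ _ _ (O°⊆𝓔₁ _ _ _ o)
  arc-adj (inj₂ o) with O∘⇒reversed-O° o
  ... | t , o′ , _ = Graph.sym Γ (𝓔₁-adj _ _ t (O°⊆𝓔₁ _ _ t o′))

  -- The arc from x to u carries the color of {x, u} in 𝓔₁ if 𝓔° orients
  -- that edge from x to u, and its image under φ otherwise.
  arc-unique : ∀ {x u} → Adj Γ x u → ∃!′ (Arc O° O∘ x u)
  arc-unique {x} {u} a with 𝓔₁-unique x u a
  ... | s , c , _ with proj₁ (proj₂ orient x u s c)
  ... | inj₁ o = s , inj₁ o , least
    where
    least : ∀ t → Arc O° O∘ x u t → s ≡ t
    least t (inj₁ o′) = O°-functional o o′
    least t (inj₂ o∘) with O∘⇒reversed-O° o∘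
    ... | _ , o′ , _ = ⊥-elim (O°-antisym o o′)
  ... | inj₂ o = φ s , inj₂ (reversed-O°⇒O∘ o) , least
    where
    least : ∀ t → Arc O° O∘ x u t → φ s ≡ t
    least t (inj₁ o′) = ⊥-elim (O°-antisym o o′)
    least t (inj₂ o∘) with O∘⇒reversed-O° o∘
    ... | _ , o′ , t≡φr = trans (cong φ (O°-functional o o′)) (sym t≡φr)

  O°-separated : StrongCond Γ 𝓔₁ → ∀ {x u x′ u′ s} → O° x u s → O° x′ u′ s →
    ¬ (x ≡ x′ × u ≡ u′) → Separated Γ x u x′ u′
  O°-separated strong {x} {u} {x′} {u′} {s} o o′ distinct =
    strong x u x′ u′ s (O°⊆𝓔₁ _ _ _ o) (O°⊆𝓔₁ _ _ _ o′) otherEdge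
    where
    otherEdge : ¬ SameEdge Γ 𝓔₁ x u x′ u′
    otherEdge (inj₁ same) = distinct same
    otherEdge (inj₂ (refl , refl)) = O°-antisym o o′

  arc-separated : StrongCond Γ 𝓔₁ → ∀ {x u x′ u′ s} → Arc O° O∘ x u s → Arc O° O∘ x′ u′ s →
    ¬ (x ≡ x′ × u ≡ u′) → Separated Γ x u x′ u′
  arc-separated strong (inj₁ o) (inj₁ o′) distinct = O°-separated strong o o′ distinct
  arc-separated strong (inj₁ o) (inj₂ o′) _ =
    ⊥-elim (disjoint _ (colors° _ _ _ (O°⊆𝓔₁ _ _ _ o)) (colors∘ o′))
  arc-separated strong (inj₂ o) (inj₁ o′) _ =
    ⊥-elim (disjoint _ (colors° _ _ _ (O°⊆𝓔₁ _ _ _ o′)) (colors∘ o))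
  arc-separated strong (inj₂ o∘) (inj₂ o∘′) distinct
    with O∘⇒reversed-O° o∘ | O∘⇒reversed-O° o∘′
  ... | t , o , refl | t′ , o′ , φt≡φt′ =
    Separated-reverse {Γ} (O°-separated strong o (subst (O° _ _) (sym t≡t′) o′)
                                         (λ (u≡u′ , x≡x′) → distinct (x≡x′ , u≡u′)))
    where
    t≡t′ : t ≡ t′
    t≡t′ = φ-injective t t′ (colors° _ _ t (O°⊆𝓔₁ _ _ t o))
                            (colors° _ _ t′ (O°⊆𝓔₁ _ _ t′ o′)) φt≡φt′

  looped-isBipEdgeColoring : {𝒱 : V Γ → S → Set} → (∀ x → ∃!′ (𝒱 x)) →
    IsBipEdgeColoring (looped Γ) (loopedColoring 𝒱 O° O∘)
  looped-isBipEdgeColoring {𝒱} 𝒱-unique = adj , unique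
    where
    adj : ∀ x u s → loopedColoring 𝒱 O° O∘ x u s → Adj (looped Γ) x u
    adj x u s (inj₁ (x≡u , _)) = inj₁ x≡u
    adj x u s (inj₂ arc) = inj₂ (arc-adj arc)

    unique : ∀ x u → Adj (looped Γ) x u → ∃!′ (loopedColoring 𝒱 O° O∘ x u)
    unique x .x (inj₁ refl) with 𝒱-unique x
    ... | s , 𝒱xs , least = s , inj₁ (refl , 𝒱xs) , λ where
      t (inj₁ (_ , 𝒱xt)) → least t 𝒱xt
      t (inj₂ arc) → ⊥-elim (Graph.irrefl Γ (arc-adj arc))
    unique x u (inj₂ a) with arc-unique a
    ... | s , arc , least = s , inj₂ arc , λ where
      t (inj₁ (refl , _)) → ⊥-elim (Graph.irrefl Γ a)
      t (inj₂ arc′) → least t arc′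

  module _ {S′ : S → Set} {𝒱 : V Γ → S → Set}
           (𝒱-colors : ∀ x s → 𝒱 x s → S′ s)
           (S°∩S′ : ∀ s → S° s → ¬ S′ s)
           (S∘∩S′ : ∀ s → S∘ s → ¬ S′ s) where

    loop-arc-clash : ∀ {x y u s} → 𝒱 x s → ¬ Arc O° O∘ y u s
    loop-arc-clash {x} {s = s} 𝒱xs arc =
      [ (λ s° → S°∩S′ s s° S′s) , (λ s∘ → S∘∩S′ s s∘ S′s) ] (arc-colors arc)
      where
      S′s : S′ s
      S′s = 𝒱-colors x s 𝒱xs

    looped-bipStrongCond : StrongCond Γ 𝓔₁ → (∀ x u s → Adj Γ x u → 𝒱 x s → ¬ 𝒱 u s) →
      BipStrongCond (looped Γ) (loopedColoring 𝒱 O° O∘)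
    looped-bipStrongCond _ 𝒱-proper x .x x′ .x′ s
      (inj₁ (refl , 𝒱xs)) (inj₁ (refl , 𝒱x′s)) distinct =
        (x≢x′ , x≢x′) ,
        [ x≢x′ , (λ a → 𝒱-proper x x′ s a 𝒱xs 𝒱x′s) ] ,
        [ x≢x′ ∘ sym , (λ a → 𝒱-proper x′ x s a 𝒱x′s 𝒱xs) ]
      where
      x≢x′ : x ≢ x′
      x≢x′ x≡x′ = distinct (x≡x′ , x≡x′)
    looped-bipStrongCond _ _ _ _ _ _ _ (inj₁ (_ , 𝒱xs)) (inj₂ arc) _ =
      ⊥-elim (loop-arc-clash 𝒱xs arc)
    looped-bipStrongCond _ _ _ _ _ _ _ (inj₂ arc) (inj₁ (_ , 𝒱xs)) _ =
      ⊥-elim (loop-arc-clash 𝒱xs arc)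
    looped-bipStrongCond strong _ _ _ _ _ _ (inj₂ arc) (inj₂ arc′) distinct =
      Separated⇒looped-separated {Γ} (arc-separated strong arc arc′ distinct)

    looped-bipColorsFrom :
      BipColorsFrom (looped Γ) (loopedColoring 𝒱 O° O∘) (λ s → S′ s ⊎ S° s ⊎ S∘ s)
    looped-bipColorsFrom x u s (inj₁ (_ , 𝒱xs)) = inj₁ (𝒱-colors x s 𝒱xs)
    looped-bipColorsFrom x u s (inj₂ arc) = inj₂ (arc-colors arc)

lemma5 : (Γ₁ : Graph) (Γ₂ : BipGraph) (S S₂ : Set)
    (𝓔₁ : V Γ₁ → V Γ₁ → S → Set)
    (𝓔₂ : L Γ₂ → R Γ₂ → S₂ → Set)
    (O° O∘ : V Γ₁ → V Γ₁ → S → Set)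
    (S° S∘ S′ : S → Set)
    (𝒱 : V Γ₁ → S → Set) →
    IsStrongEdgeColoring Γ₁ 𝓔₁ →
    IsBipStrongEdgeColoring Γ₂ 𝓔₂ →
    OpposingOrientations Γ₁ 𝓔₁ O° O∘ S° S∘ →
    IsProperVertexColoring Γ₁ 𝒱 →
    (∀ x s → 𝒱 x s → S′ s) →
    (∀ s → S° s → ¬ S′ s) →
    (∀ s → S∘ s → ¬ S′ s) →
    IsBipStrongEdgeColoring (Γ₁ ∶ Γ₂) (productColoring Γ₁ Γ₂ 𝓔₂ 𝒱 O° O∘)
    × BipColorsFrom (Γ₁ ∶ Γ₂) (productColoring Γ₁ Γ₂ 𝓔₂ 𝒱 O° O∘)
        (λ { (s , s₂) → S′ s ⊎ S° s ⊎ S∘ s })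
lemma5 Γ₁ Γ₂ S S₂ 𝓔₁ 𝓔₂ O° O∘ S° S∘ S′ 𝒱
  (isColoring₁ , _ , strong₁) isStrong₂ opposing (𝒱-unique , 𝒱-proper)
  𝒱-colors S°∩S′ S∘∩S′ =
    ⊗-isBipStrongEdgeColoring {H₁ = looped Γ₁} isStrongLooped isStrong₂ ,
    ⊗-bipColorsFrom {H₁ = looped Γ₁} {H₂ = Γ₂} {C₂ = 𝓔₂}
      (looped-bipColorsFrom isColoring₁ opposing 𝒱-colors S°∩S′ S∘∩S′)
  where
  isStrongLooped : IsBipStrongEdgeColoring (looped Γ₁) (loopedColoring 𝒱 O° O∘)
  isStrongLooped = isBipStrongEdgeColoring {looped Γ₁}
    (looped-isBipEdgeColoring isColoring₁ opposing 𝒱-unique)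
    (looped-bipStrongCond isColoring₁ opposing 𝒱-colors S°∩S′ S∘∩S′ strong₁ 𝒱-proper)
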